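{- (Validity for local substitutions in the contextual system.) If $\Psi;\Gamma\vdash_i\delta:\Delta$, then $\mathrm{core}\,\Psi$, and if $i=0$ then $\mathrm{core}\,\Gamma$ and $\mathrm{core}\,\Delta$, and if $i=1$ then $\mathrm{type}\,\Gamma$ and $\mathrm{type}\,\Delta$.
   Context: Types: $T::=\mathsf{Nat}\mid(\Gamma\vdash T)\mid S\to T$. Core types ($\mathrm{core}$): built from $\mathsf{Nat}$, $\to$. Valid types ($\mathrm{type}$): $\mathsf{Nat}$; $S\to T$ with $S,T$ valid; $(\Gamma\vdash T)$ with $\Gamma$ and $T$ core. Local contexts $\Gamma::=\cdot\mid\Gamma,x:T$; global contexts $\Psi::=\cdot\mid\Psi,u:(\Gamma\vdash T)$; $\mathrm{core}\,\Psi$ means all types occurring in $\Psi$ (including in local contexts of bindings) are core; $\mathrm{core}/\mathrm{type}$ on local contexts are pointwise. Local substitutions $\delta::=\cdot\mid\delta,t/x$. Terms $t::=x\mid u^\delta\mid\mathsf{zero}\mid\mathsf{succ}\,t\mid\mathsf{box}\,t\mid\mathsf{letbox}\,u=s\,\mathsf{in}\,t\mid\mathsf{match}\,t\ \vec b\mid\lambda x.t\mid s\ t$; branches $b::=\mathsf{var}\,x\Rightarrow t\mid\mathsf{zero}\Rightarrow t\mid\mathsf{succ}\,?u\Rightarrow t\mid\lambda x.?u\Rightarrow t\mid ?u\ ?u'\Rightarrow t$. With $C_0$="$\mathrm{core}\,\Psi$, $\mathrm{core}\,\Gamma$", $C_1$="$\mathrm{core}\,\Psi$, $\mathrm{type}\,\Gamma$",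 typing ($i\in\{0,1\}$) is mutually inductive: under $C_i$: $\Psi;\Gamma\vdash_i\mathsf{zero}:\mathsf{Nat}$, $\Psi;\Gamma\vdash_i x:T$ for $x:T\in\Gamma$, $\Psi;\Gamma\vdash_i\cdot:\cdot$; $\Psi;\Gamma\vdash_i\delta:\Delta$, $\Psi;\Gamma\vdash_i t:T$ give $\Psi;\Gamma\vdash_i\delta,t/x:\Delta,x:T$; $\Psi;\Gamma\vdash_i\delta:\Delta$, $u:(\Delta\vdash T)\in\Psi$ give $\Psi;\Gamma\vdash_i u^\delta:T$; succ, $\lambda$, application at layer $i$; $\mathrm{type}\,\Gamma$ and $\Psi;\Delta\vdash_0 t:T$ give $\Psi;\Gamma\vdash_1\mathsf{box}\,t:(\Delta\vdash T)$; $\mathsf{letbox}$ and $\mathsf{match}$ exist only at layer 1 ($\Psi;\Gamma\vdash_1 s:(\Delta\vdash T)$ with $\Psi,u:(\Delta\vdash T);\Gamma\vdash_1 t:T'$, resp. with a covering well-typed list of branches $\Psi;\Gamma\vdash_1\vec b:(\Delta\vdash T\Rightarrow T')$, give type $T'$), where branch bodies are typed at layer 1 in $\Gamma$ with the global context extended by the pattern variables ($u:(\Delta\vdash\mathsf{Nat})$ for $\mathsf{succ}\,?u$; $u:(\Delta,x:S\vdash T_0)$ for $\lambda x.?u$ at $T=S\to T_0$; $u:(\Delta\vdash S\to T),u':(\Delta\vdash S)$ for every core $S$ for $?u\ ?u'$), and $\mathsf{var}\,x$/$\mathsf{zero}$ branches require $\mathrm{core}\,\Delta$. -}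

module Defs where

open import Data.Nat using (ℕ)
open import Data.Product using (_×_; _,_; proj₁; proj₂)
open import Data.List using (List; []; _∷_)
open import Data.List.Relation.Unary.All using (All)
open import Data.List.Relation.Unary.Any using (Any)
open import Data.List.Membership.Propositional using (_∈_)
open import Relation.Binary.PropositionalEquality using (_≡_)

Var : Set
Var = ℕ

MVar : Set
MVar = ℕ

-- Types  T ::= Nat | (Γ ⊢ T) | S → T
-- Local contexts are lists whose HEAD is the most recent binding:
--   Γ , x : T   is   (x , T) ∷ Γ
data Ty : Set where
  Nat   : Ty
  ctxTy : List (Var × Ty) → Ty → Ty
  _⟶_   : Ty → Ty → Ty

infixr 20 _⟶_

LCtx : Set
LCtx = List (Var × Ty)

-- Global contexts  Ψ ::= · | Ψ , u : (Γ ⊢ T) ;  Ψ , u:(Γ ⊢ T) is (u , Γ , T) ∷ Ψ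
GCtx : Set
GCtx = List (MVar × LCtx × Ty)

data Core : Ty → Set where
  core-nat : Core Nat
  core-arr : ∀ {S T} → Core S → Core T → Core (S ⟶ T)

CoreCtx : LCtx → Set
CoreCtx Γ = All (λ b → Core (proj₂ b)) Γ

data Valid : Ty → Set where
  valid-nat : Valid Nat
  valid-arr : ∀ {S T} → Valid S → Valid T → Valid (S ⟶ T)
  valid-ctx : ∀ {Γ T} → CoreCtx Γ → Core T → Valid (ctxTy Γ T)

TypeCtx : LCtx → Set
TypeCtx Γ = All (λ b → Valid (proj₂ b)) Γ

CoreG : GCtx → Set
CoreG Ψ = All (λ b → CoreCtx (proj₁ (proj₂ b)) × Core (proj₂ (proj₂ b))) Ψ

mutual
  data Tm : Set where
    var    : Var → Tm
    mvar   : MVar → Sub → Tm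
    zero   : Tm
    succ   : Tm → Tm
    box    : Tm → Tm
    letbox : MVar → Tm → Tm → Tm
    match  : Tm → List Br → Tm
    lam    : Var → Tm → Tm
    app    : Tm → Tm → Tm

  data Sub : Set where
    ·      : Sub
    _,_/_  : Sub → Tm → Var → Sub

  data Br : Set where
    bvar  : Var → Tm → Br
    bzero : Tm → Br
    bsucc : MVar → Tm → Br
    blam  : Var → MVar → Tm → Br
    bapp  : MVar → MVar → Tm → Br

-- Coverage of a branch list for scrutinee type (Δ ⊢ T):
-- one branch for every syntactic shape a core term of type T in Δ may have:
-- a  var x  branch for every x : T ∈ Δ, zero and succ branches when T = Nat,
-- a λ branch when T is a function type, and an application branch.
Covering : LCtx → Ty → List Br → Set
Covering Δ T bs =
    (∀ x → (x , T) ∈ Δ → Any (λ b → IsVar x b) bs)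
  × (T ≡ Nat → Any IsZero bs × Any IsSucc bs)
  × (∀ {S T₀} → T ≡ (S ⟶ T₀) → Any IsLam bs)
  × Any IsApp bs
  where
  data IsVar (x : Var) : Br → Set where
    is : ∀ t → IsVar x (bvar x t)
  data IsZero : Br → Set where
    is : ∀ t → IsZero (bzero t)
  data IsSucc : Br → Set where
    is : ∀ u t → IsSucc (bsucc u t)
  data IsLam : Br → Set where
    is : ∀ x u t → IsLam (blam x u t)
  data IsApp : Br → Set where
    is : ∀ u u' t → IsApp (bapp u u' t)

data Layer : Set where
  L0 L1 : Layer

LayerCtx : Layer → LCtx → Set
LayerCtx L0 Γ = CoreCtx Γ
LayerCtx L1 Γ = TypeCtx Γ

-- Typing:  TmTy i Ψ Γ t T   is   Ψ;Γ ⊢_i t : T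
--          SubTy i Ψ Γ δ Δ  is   Ψ;Γ ⊢_i δ : Δ
--          BrsTy Ψ Γ bs Δ T T'  is  Ψ;Γ ⊢_1 bs : (Δ ⊢ T ⇒ T')
mutual
  data TmTy : Layer → GCtx → LCtx → Tm → Ty → Set where
    t-zero : ∀ {i Ψ Γ} → CoreG Ψ → LayerCtx i Γ → TmTy i Ψ Γ zero Nat
    t-var  : ∀ {i Ψ Γ x T} → CoreG Ψ → LayerCtx i Γ → (x , T) ∈ Γ →
             TmTy i Ψ Γ (var x) T
    t-mvar : ∀ {i Ψ Γ δ Δ u T} → SubTy i Ψ Γ δ Δ → (u , Δ , T) ∈ Ψ →
             TmTy i Ψ Γ (mvar u δ) T
    t-succ : ∀ {i Ψ Γ t} → TmTy i Ψ Γ t Nat → TmTy i Ψ Γ (succ t) Nat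
    t-lam  : ∀ {i Ψ Γ x t S T} → TmTy i Ψ ((x , S) ∷ Γ) t T →
             TmTy i Ψ Γ (lam x t) (S ⟶ T)
    t-app  : ∀ {i Ψ Γ s t S T} → TmTy i Ψ Γ s (S ⟶ T) → TmTy i Ψ Γ t S →
             TmTy i Ψ Γ (app s t) T
    t-box  : ∀ {Ψ Γ Δ t T} → TypeCtx Γ → TmTy L0 Ψ Δ t T →
             TmTy L1 Ψ Γ (box t) (ctxTy Δ T)
    t-letbox : ∀ {Ψ Γ Δ u s t T T'} → TmTy L1 Ψ Γ s (ctxTy Δ T) →
             TmTy L1 ((u , Δ , T) ∷ Ψ) Γ t T' →
             TmTy L1 Ψ Γ (letbox u s t) T'
    t-match : ∀ {Ψ Γ Δ t bs T T'} → TmTy L1 Ψ Γ t (ctxTy Δ T) →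
             Covering Δ T bs → BrsTy Ψ Γ bs Δ T T' →
             TmTy L1 Ψ Γ (match t bs) T'

  data SubTy : Layer → GCtx → LCtx → Sub → LCtx → Set where
    s-nil  : ∀ {i Ψ Γ} → CoreG Ψ → LayerCtx i Γ → SubTy i Ψ Γ · []
    s-cons : ∀ {i Ψ Γ δ Δ t x T} → SubTy i Ψ Γ δ Δ → TmTy i Ψ Γ t T →
             SubTy i Ψ Γ (δ , t / x) ((x , T) ∷ Δ)

  data BrTy : GCtx → LCtx → Br → LCtx → Ty → Ty → Set where
    b-var  : ∀ {Ψ Γ Δ x t T T'} → CoreCtx Δ → TmTy L1 Ψ Γ t T' →
             BrTy Ψ Γ (bvar x t) Δ T T'
    b-zero : ∀ {Ψ Γ Δ t T T'} → CoreCtx Δ → TmTy L1 Ψ Γ t T' →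
             BrTy Ψ Γ (bzero t) Δ T T'
    b-succ : ∀ {Ψ Γ Δ u t T T'} → TmTy L1 ((u , Δ , Nat) ∷ Ψ) Γ t T' →
             BrTy Ψ Γ (bsucc u t) Δ T T'
    b-lam  : ∀ {Ψ Γ Δ x u t S T₀ T'} →
             TmTy L1 ((u , (x , S) ∷ Δ , T₀) ∷ Ψ) Γ t T' →
             BrTy Ψ Γ (blam x u t) Δ (S ⟶ T₀) T'
    b-app  : ∀ {Ψ Γ Δ u u' t T T'} →
             (∀ S → Core S →
                TmTy L1 ((u' , Δ , S) ∷ (u , Δ , S ⟶ T) ∷ Ψ) Γ t T') →
             BrTy Ψ Γ (bapp u u' t) Δ T T'

  data BrsTy : GCtx → LCtx → List Br → LCtx → Ty → Ty → Set where
    bs-nil  : ∀ {Ψ Γ Δ T T'} → BrsTy Ψ Γ [] Δ T T'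
    bs-cons : ∀ {Ψ Γ Δ T T' b bs} → BrTy Ψ Γ b Δ T T' →
              BrsTy Ψ Γ bs Δ T T' → BrsTy Ψ Γ (b ∷ bs) Δ T T'

-- Induction on derivations, generalised to all four judgements: every judgement at layer i
-- only mentions a core global context, a local context of layer i and, for terms, a type of
-- layer i (core at layer 0, valid at layer 1). The layer-1 constructs never lose this
-- information: box returns a contextual type built from a layer-0 derivation, global
-- variables have core (hence valid) types, and letbox/match take their type from a body.
module Submission where

open import Defs
open import Function using (_∘_)
open import Data.Product using (_×_; _,_; proj₂)
open import Data.List using ([]; _∷_)
open import Data.List.Relation.Unary.All using (All; []; _∷_; lookup)
open import Data.List.Relation.Unary.Any using (Any; here; there)
open import Relation.Binary.PropositionalEquality using (_≡_; refl)

LayerTy : Layer → Ty → Set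
LayerTy L0 = Core
LayerTy L1 = Valid

core⇒valid : ∀ {T} → Core T → Valid T
core⇒valid core-nat         = valid-nat
core⇒valid (core-arr cS cT) = valid-arr (core⇒valid cS) (core⇒valid cT)

core⇒layerTy : ∀ i {T} → Core T → LayerTy i T
core⇒layerTy L0 = λ cT → cT
core⇒layerTy L1 = core⇒valid

layerTy-nat : ∀ i → LayerTy i Nat
layerTy-nat L0 = core-nat
layerTy-nat L1 = valid-nat

layerTy-arr : ∀ i {S T} → LayerTy i S → LayerTy i T → LayerTy i (S ⟶ T)
layerTy-arr L0 = core-arr
layerTy-arr L1 = valid-arr

layerTy-cod : ∀ i {S T} → LayerTy i (S ⟶ T) → LayerTy i T
layerTy-cod L0 (core-arr _ cT)  = cT
layerTy-cod L1 (valid-arr _ vT) = vT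

LayerCtx⇒All : ∀ i {Γ} → LayerCtx i Γ → All (LayerTy i ∘ proj₂) Γ
LayerCtx⇒All L0 cΓ = cΓ
LayerCtx⇒All L1 vΓ = vΓ

All⇒LayerCtx : ∀ i {Γ} → All (LayerTy i ∘ proj₂) Γ → LayerCtx i Γ
All⇒LayerCtx L0 cΓ = cΓ
All⇒LayerCtx L1 vΓ = vΓ

mutual
  tmTy-wf : ∀ {i Ψ Γ t T} → TmTy i Ψ Γ t T →
            CoreG Ψ × LayerCtx i Γ × LayerTy i T
  tmTy-wf {i} (t-zero cΨ wΓ) = cΨ , wΓ , layerTy-nat i
  tmTy-wf {i} (t-var cΨ wΓ x∈Γ) = cΨ , wΓ , lookup (LayerCtx⇒All i wΓ) x∈Γ
  tmTy-wf {i} (t-mvar dδ u∈Ψ) with subTy-wf dδ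
  ... | cΨ , wΓ , _ = cΨ , wΓ , core⇒layerTy i (proj₂ (lookup cΨ u∈Ψ))
  tmTy-wf (t-succ dt) = tmTy-wf dt
  tmTy-wf {i} (t-lam dt) with tmTy-wf dt
  ... | cΨ , wSΓ , wT with LayerCtx⇒All i wSΓ
  ...   | wS ∷ wΓ = cΨ , All⇒LayerCtx i wΓ , layerTy-arr i wS wT
  tmTy-wf {i} (t-app ds _) with tmTy-wf ds
  ... | cΨ , wΓ , wST = cΨ , wΓ , layerTy-cod i wST
  tmTy-wf (t-box vΓ dt) with tmTy-wf dt
  ... | cΨ , cΔ , cT = cΨ , vΓ , valid-ctx cΔ cT
  tmTy-wf (t-letbox ds dt) with tmTy-wf ds
  ... | cΨ , vΓ , _ = cΨ , vΓ , proj₂ (proj₂ (tmTy-wf dt))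
  -- A covering branch list contains an application branch, so it is nonempty and
  -- some branch body witnesses that the result type is valid.
  tmTy-wf (t-match ds (_ , _ , _ , app∈bs) dbs) with tmTy-wf ds
  ... | cΨ , vΓ , _ = cΨ , vΓ , brsTy-valid dbs app∈bs

  brsTy-valid : ∀ {Ψ Γ bs Δ T T'} {P : Br → Set} →
                BrsTy Ψ Γ bs Δ T T' → Any P bs → Valid T'
  brsTy-valid (bs-cons db _)   (here _)  = brTy-valid db
  brsTy-valid (bs-cons _ dbs) (there p) = brsTy-valid dbs p

  brTy-valid : ∀ {Ψ Γ b Δ T T'} → BrTy Ψ Γ b Δ T T' → Valid T'
  brTy-valid (b-var _ dt)  = proj₂ (proj₂ (tmTy-wf dt))
  brTy-valid (b-zero _ dt) = proj₂ (proj₂ (tmTy-wf dt))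
  brTy-valid (b-succ dt)   = proj₂ (proj₂ (tmTy-wf dt))
  brTy-valid (b-lam dt)    = proj₂ (proj₂ (tmTy-wf dt))
  brTy-valid (b-app dt)    = proj₂ (proj₂ (tmTy-wf (dt Nat core-nat)))

  subTy-wf : ∀ {i Ψ Γ δ Δ} → SubTy i Ψ Γ δ Δ →
             CoreG Ψ × LayerCtx i Γ × LayerCtx i Δ
  subTy-wf {i} (s-nil cΨ wΓ) = cΨ , wΓ , All⇒LayerCtx i []
  subTy-wf {i} (s-cons dδ dt) with subTy-wf dδ
  ... | cΨ , wΓ , wΔ =
    cΨ , wΓ , All⇒LayerCtx i (proj₂ (proj₂ (tmTy-wf dt)) ∷ LayerCtx⇒All i wΔ)

mainTheorem12 : ∀ {i Ψ Γ δ Δ} → SubTy i Ψ Γ δ Δ →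
    CoreG Ψ
    × (i ≡ L0 → CoreCtx Γ × CoreCtx Δ)
    × (i ≡ L1 → TypeCtx Γ × TypeCtx Δ)
mainTheorem12 dδ with subTy-wf dδ
... | cΨ , wΓ , wΔ = cΨ , (λ { refl → wΓ , wΔ }) , (λ { refl → wΓ , wΔ })
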